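{- The set of internal parking functions of $BW_n$ is $S_-(BW_n)=\{s\in\{0,1\}^n: s(n)=0\}$.
   Context: The broken wheel graph $BW_n$ is the multigraph on vertices $0,\dots,n$ with two parallel edges between $0$ and $1$, one edge $0$–$i$ for each $2\le i\le n$, and one edge $i$–$(i+1)$ for $1\le i\le n-1$. For $1\le i\le k\le j\le n$, $d(i,k,j)$ is the number of edges joining $k$ to a vertex outside $\{i,\dots,j\}$. A parking function is $s\in\mathbb{N}^n$ such that for all $1\le i\le j\le n$ there is $k\in\{i,\dots,j\}$ with $s(k)<d(i,k,j)$. An internal parking function is a parking function $s$ such that for all $1\le i\le j\le n$, either there is $k\in\{i,\dots,j-1\}$ with $s(k)<d(i,k,j)$, or $s(j)<d(i,j,j)-1$. -}

module Defs where

open import Data.Nat using (ℕ; zero; suc; _+_; _≤_; _<_; _∸_; _≡ᵇ_; _<ᵇ_)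
open import Data.Bool using (Bool; true; false; _∧_; _∨_; not; if_then_else_)
open import Data.Product using (_×_; _,_; ∃-syntax)
open import Data.Sum using (_⊎_)
open import Data.List using (List; []; _∷_; _++_; map; upTo; length; filterᵇ)
open import Data.Fin using (Fin; toℕ)
import Data.Fin as F

Edge : Set
Edge = ℕ × ℕ

-- Edge list of the broken wheel BW_n on vertices 0,…,n:
--   two parallel edges 0–1, edges 0–i for 2 ≤ i ≤ n, edges i–(i+1) for 1 ≤ i ≤ n-1.
BW : ℕ → List Edge
BW n = (0 , 1) ∷ (0 , 1) ∷
       (map (λ t → (0 , t + 2)) (upTo (n ∸ 1)) ++
        map (λ t → (t + 1 , t + 2)) (upTo (n ∸ 1)))

inInterval : ℕ → ℕ → ℕ → Bool
inInterval i j v = (i ≤ᵇ' v) ∧ (v ≤ᵇ' j)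
  where
  _≤ᵇ'_ : ℕ → ℕ → Bool
  a ≤ᵇ' b = a <ᵇ suc b

joinsOutside : ℕ → ℕ → ℕ → Edge → Bool
joinsOutside i k j (u , v) =
  ((u ≡ᵇ k) ∧ not (inInterval i j v)) ∨ ((v ≡ᵇ k) ∧ not (inInterval i j u))

d : ℕ → ℕ → ℕ → ℕ → ℕ
d n i k j = length (filterᵇ (joinsOutside i k j) (BW n))

-- Configurations s ∈ ℕ^n are functions Fin n → ℕ; index x : Fin n stands for
-- vertex toℕ x + 1 ∈ {1,…,n}.
vtx : {n : ℕ} → Fin n → ℕ
vtx x = suc (toℕ x)

IsParkingFunction : (n : ℕ) → (Fin n → ℕ) → Set
IsParkingFunction n s =
  (i j : Fin n) → i F.≤ j →
  ∃[ k ] ((i F.≤ k) × (k F.≤ j) × (s k < d n (vtx i) (vtx k) (vtx j)))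

IsInternalParkingFunction : (n : ℕ) → (Fin n → ℕ) → Set
IsInternalParkingFunction n s =
  IsParkingFunction n s ×
  ((i j : Fin n) → i F.≤ j →
     (∃[ k ] ((i F.≤ k) × (k F.< j) × (s k < d n (vtx i) (vtx k) (vtx j))))
     ⊎ (s j < d n (vtx i) (vtx j) (vtx j) ∸ 1))

-- For i = j the internal condition reads s(k) < deg(k) − 1, and in BW_n a vertex k < n has
-- degree 3 while k = n has degree 2; so internal parking functions take values in {0,1} and
-- vanish at n. Conversely, for such s the left endpoint i of every interval {i,…,j} is a
-- witness, because s(i) ≤ 1 < 2 ≤ d(i,i,j): vertex 1 has its double edge to 0, and a vertex
-- i ≥ 2 its edges to 0 and i − 1. The values of d are computed by induction on n, BW_{n+1}
-- arising from BW_n by adding vertex n+1 with its edges to 0 and n.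
module Submission where

open import Defs
open import Data.Nat using (ℕ; suc; _≤_)
open import Data.Fin using (Fin; fromℕ)
open import Data.Product using (_×_)
open import Relation.Binary.PropositionalEquality using (_≡_)
open import Function.Bundles using (_⇔_)

open import Data.Bool using (Bool; true; false; T)
open import Data.Bool.Properties using (T-≡; ¬-not; ∧-zeroʳ)
open import Data.Empty using (⊥-elim)
open import Data.Fin using (toℕ)
import Data.Fin as F
open import Data.Fin.Properties using (toℕ-fromℕ; toℕ-injective; toℕ≤pred[n]; toℕ<n)
open import Data.List using (List; []; _∷_; _++_; [_]; map; upTo; length; filterᵇ)
open import Data.List.Properties using (length-++; filter-++; filter-accept; filter-reject; map-++; upTo-∷ʳ)
open import Data.Nat using (zero; _+_; _<_; _∸_; _≡ᵇ_; _<ᵇ_; z≤n; z<s; s≤s; s≤s⁻¹; _≤′_; ≤′-refl; ≤′-step)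
open import Data.Nat.Properties
open import Data.Product using (_,_; proj₁; ∃-syntax)
open import Data.Sum using (_⊎_; inj₁; inj₂)
open import Function using (_∘_; mk⇔; Equivalence)
open import Relation.Binary.PropositionalEquality using (_≢_; refl; sym; trans; cong; cong₂; subst; module ≡-Reasoning)
open import Relation.Nullary.Decidable using (T?)

open import Algebra.Properties.CommutativeSemigroup +-commutativeSemigroup using (interchange)

count : {A : Set} → (A → Bool) → List A → ℕ
count p xs = length (filterᵇ p xs)

module _ {A : Set} (p : A → Bool) where

  count-++ : (xs ys : List A) → count p (xs ++ ys) ≡ count p xs + count p ys
  count-++ xs ys = trans (cong length (filter-++ (T? ∘ p) xs ys)) (length-++ (filterᵇ p xs))

  count-accept : ∀ x xs → p x ≡ true → count p (x ∷ xs) ≡ suc (count p xs)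
  count-accept _ _ px = cong length (filter-accept (T? ∘ p) (Equivalence.from T-≡ px))

  count-reject : ∀ x xs → p x ≡ false → count p (x ∷ xs) ≡ count p xs
  count-reject _ _ px = cong length (filter-reject (T? ∘ p) (subst T px))

≡ᵇ-refl : ∀ n → (n ≡ᵇ n) ≡ true
≡ᵇ-refl n = Equivalence.to T-≡ (≡⇒≡ᵇ n n refl)

≢⇒≡ᵇ-false : ∀ {m n} → m ≢ n → (m ≡ᵇ n) ≡ false
≢⇒≡ᵇ-false {m} {n} m≢n = ¬-not (m≢n ∘ ≡ᵇ⇒≡ m n ∘ Equivalence.from T-≡)

<ᵇ-irrefl : ∀ n → (n <ᵇ n) ≡ false
<ᵇ-irrefl n = ¬-not (<-irrefl refl ∘ <ᵇ⇒< n n ∘ Equivalence.from T-≡)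

newEdges : ℕ → List Edge
newEdges m = (0 , 2 + m) ∷ (1 + m , 2 + m) ∷ []

d-step : ∀ m i k j →
  d (2 + m) i k j ≡ d (1 + m) i k j + count (joinsOutside i k j) (newEdges m)
d-step m i k j = begin
  d (2 + m) i k j
    ≡⟨ split (suc m) ⟩
  c double + (c (spokes (suc m)) + c (rim (suc m)))
    ≡⟨ cong (c double +_) (cong₂ _+_ (grow spoke) (grow rung)) ⟩
  c double + ((c (spokes m) + c [ spoke m ]) + (c (rim m) + c [ rung m ]))
    ≡⟨ cong (c double +_) (interchange (c (spokes m)) _ _ _) ⟩
  c double + ((c (spokes m) + c (rim m)) + (c [ spoke m ] + c [ rung m ]))
    ≡⟨ sym (+-assoc (c double) _ _) ⟩
  (c double + (c (spokes m) + c (rim m))) + (c [ spoke m ] + c [ rung m ])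
    ≡⟨ cong₂ _+_ (sym (split m)) (sym (count-++ P [ spoke m ] [ rung m ])) ⟩
  d (1 + m) i k j + c (spoke m ∷ rung m ∷ [])
    ≡⟨ cong (d (1 + m) i k j +_) (cong₂ (λ u v → c ((0 , v) ∷ (u , v) ∷ [])) (+-comm m 1) (+-comm m 2)) ⟩
  d (1 + m) i k j + c (newEdges m) ∎
  where
  open ≡-Reasoning
  P = joinsOutside i k j
  c = count P
  double : List Edge
  double = (0 , 1) ∷ (0 , 1) ∷ []
  spoke rung : ℕ → Edge
  spoke t = (0 , t + 2)
  rung t = (t + 1 , t + 2)
  spokes rim : ℕ → List Edge
  spokes n = map spoke (upTo n)
  rim n = map rung (upTo n)
  split : ∀ n → d (1 + n) i k j ≡ c double + (c (spokes n) + c (rim n))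
  split n = trans (count-++ P double _) (cong (c double +_) (count-++ P (spokes n) _))
  grow : (f : ℕ → Edge) → c (map f (upTo (suc m))) ≡ c (map f (upTo m)) + c [ f m ]
  grow f = begin
    c (map f (upTo (suc m)))      ≡⟨ cong (c ∘ map f) (sym (upTo-∷ʳ m)) ⟩
    c (map f (upTo m ++ [ m ]))   ≡⟨ cong c (map-++ f (upTo m) [ m ]) ⟩
    c (map f (upTo m) ++ [ f m ]) ≡⟨ count-++ P (map f (upTo m)) _ ⟩
    c (map f (upTo m)) + c [ f m ] ∎

newEdges-at-newVertex : ∀ m j → count (joinsOutside (2 + m) (2 + m) j) (newEdges m) ≡ 2
newEdges-at-newVertex m j =
  trans (count-accept P (0 , 2 + m) _ spoke) (cong suc (count-accept P (1 + m , 2 + m) [] rung))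
  where
  P = joinsOutside (2 + m) (2 + m) j
  spoke : P (0 , 2 + m) ≡ true
  spoke rewrite ≡ᵇ-refl m = refl
  rung : P (1 + m , 2 + m) ≡ true
  rung rewrite ≢⇒≡ᵇ-false (1+n≢n {m} ∘ sym) | ≡ᵇ-refl m | <ᵇ-irrefl m = refl

newEdges-at-previousVertex : ∀ m → count (joinsOutside (1 + m) (1 + m) (1 + m)) (newEdges m) ≡ 1
newEdges-at-previousVertex m =
  trans (count-reject P (0 , 2 + m) _ spoke) (count-accept P (1 + m , 2 + m) [] rung)
  where
  P = joinsOutside (1 + m) (1 + m) (1 + m)
  spoke : P (0 , 2 + m) ≡ false
  spoke rewrite ≢⇒≡ᵇ-false (1+n≢n {m}) = refl
  rung : P (1 + m , 2 + m) ≡ true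
  rung rewrite ≡ᵇ-refl m | <ᵇ-irrefl m | ∧-zeroʳ (m <ᵇ 2 + m) = refl

newEdges-elsewhere : ∀ m i k j → suc k ≢ 1 + m → suc k ≢ 2 + m →
  count (joinsOutside i (suc k) j) (newEdges m) ≡ 0
newEdges-elsewhere m i k j k≢1+m k≢2+m =
  trans (count-reject P (0 , 2 + m) _ spoke) (count-reject P (1 + m , 2 + m) [] rung)
  where
  P = joinsOutside i (suc k) j
  spoke : P (0 , 2 + m) ≡ false
  spoke rewrite ≢⇒≡ᵇ-false (k≢2+m ∘ cong suc ∘ sym) = refl
  rung : P (1 + m , 2 + m) ≡ false
  rung rewrite ≢⇒≡ᵇ-false (k≢1+m ∘ cong suc ∘ sym) | ≢⇒≡ᵇ-false (k≢2+m ∘ cong suc ∘ sym) = refl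

d-nonvertex : ∀ m i k j → 1 + m < k → d (1 + m) i k j ≡ 0
d-nonvertex zero    i (suc zero)    j (s≤s ())
d-nonvertex zero    i (suc (suc k)) j _ = refl
d-nonvertex (suc m) i (suc k) j 2+m<1+k = trans (d-step m i (suc k) j)
  (cong₂ _+_ (d-nonvertex m i (suc k) j (<-trans (n<1+n (suc m)) 2+m<1+k))
             (newEdges-elsewhere m i k j (>⇒≢ (<-trans (n<1+n (suc m)) 2+m<1+k)) (>⇒≢ 2+m<1+k)))

d-last-vertex : ∀ m → d (1 + m) (1 + m) (1 + m) (1 + m) ≡ 2
d-last-vertex zero    = refl
d-last-vertex (suc m) = trans (d-step m v v v)
  (cong₂ _+_ (d-nonvertex m v v v (n<1+n (suc m))) (newEdges-at-newVertex m v))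
  where v = 2 + m

d-inner-vertex : ∀ m x → x < m → d (1 + m) (1 + x) (1 + x) (1 + x) ≡ 3
d-inner-vertex (suc m) x x<1+m with m≤n⇒m<n∨m≡n (s≤s⁻¹ x<1+m)
... | inj₁ x<m = trans (d-step m v v v)
  (cong₂ _+_ (d-inner-vertex m x x<m) (newEdges-elsewhere m v x v (<⇒≢ (s≤s x<m)) (<⇒≢ (m<n⇒m<1+n (s≤s x<m)))))
  where v = 1 + x
... | inj₂ refl = trans (d-step m v v v) (cong₂ _+_ (d-last-vertex m) (newEdges-at-previousVertex m))
  where v = 1 + m

d-grows : ∀ m i k j → d (1 + m) i k j ≤ d (2 + m) i k j
d-grows m i k j = subst (d (1 + m) i k j ≤_) (sym (d-step m i k j)) (m≤m+n _ _)

d-mono : ∀ {m n} i k j → m ≤′ n → d (1 + m) i k j ≤ d (1 + n) i k j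
d-mono i k j ≤′-refl         = ≤-refl
d-mono i k j (≤′-step {n} p) = ≤-trans (d-mono i k j p) (d-grows n i k j)

d-left-endpoint : ∀ n x j → x < n → 2 ≤ d n (1 + x) (1 + x) j
d-left-endpoint n       zero    j _           = s≤s (s≤s z≤n)  -- the double edge 0–1 heads BW n
d-left-endpoint (suc n) (suc a) j (s≤s 1+a≤n) = ≤-trans at-creation (d-mono v v j (≤⇒≤′ 1+a≤n))
  where
  v = 2 + a
  at-creation : 2 ≤ d (2 + a) v v j
  at-creation = subst (2 ≤_) (sym (d-step a v v j)) (≤-trans (≤-reflexive (sym (newEdges-at-newVertex a j))) (m≤n+m _ _))

module _ {n : ℕ} {s : Fin n → ℕ} where

  internal⇒diagonal : IsInternalParkingFunction n s →
    ∀ k → s k < d n (vtx k) (vtx k) (vtx k) ∸ 1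
  internal⇒diagonal (_ , internal) k with internal k k ≤-refl
  ... | inj₁ (_ , k≤l , l<k , _) = ⊥-elim (<-irrefl refl (≤-<-trans k≤l l<k))
  ... | inj₂ bound               = bound

  diagonal⇒internal : (∀ i j → i F.≤ j → s i < d n (vtx i) (vtx i) (vtx j)) →
    (∀ k → s k < d n (vtx k) (vtx k) (vtx k) ∸ 1) → IsInternalParkingFunction n s
  diagonal⇒internal left diagonal = (λ i j i≤j → i , ≤-refl , i≤j , left i j i≤j) , internal
    where
    internal : ∀ i j → i F.≤ j →
      (∃[ k ] ((i F.≤ k) × (k F.< j) × (s k < d n (vtx i) (vtx k) (vtx j))))
      ⊎ (s j < d n (vtx i) (vtx j) (vtx j) ∸ 1)
    internal i j i≤j with m≤n⇒m<n∨m≡n i≤j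
    ... | inj₁ i<j = inj₁ (i , ≤-refl , i<j , left i j i≤j)
    ... | inj₂ i≡j = inj₂ (subst (λ j → s j < d n (vtx i) (vtx j) (vtx j) ∸ 1) (toℕ-injective i≡j) (diagonal i))

module _ {m : ℕ} where

  d-diagonal-fromℕ : d (suc m) (vtx (fromℕ m)) (vtx (fromℕ m)) (vtx (fromℕ m)) ≡ 2
  d-diagonal-fromℕ rewrite toℕ-fromℕ m = d-last-vertex m

  d-diagonal : (k : Fin (suc m)) → k ≡ fromℕ m ⊎ d (suc m) (vtx k) (vtx k) (vtx k) ≡ 3
  d-diagonal k with m≤n⇒m<n∨m≡n (toℕ≤pred[n] k)
  ... | inj₁ k<m = inj₂ (d-inner-vertex m (toℕ k) k<m)
  ... | inj₂ k≡m = inj₁ (toℕ-injective (trans k≡m (sym (toℕ-fromℕ m))))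

  diagonal⇔ : (s : Fin (suc m) → ℕ) →
    (∀ k → s k < d (suc m) (vtx k) (vtx k) (vtx k) ∸ 1) ⇔ ((∀ k → s k ≤ 1) × s (fromℕ m) ≡ 0)
  diagonal⇔ s = mk⇔ (λ diagonal → bounded diagonal , last diagonal) from
    where
    below : ∀ {k e} → d (suc m) (vtx k) (vtx k) (vtx k) ≡ e → s k < e ∸ 1 →
      s k < d (suc m) (vtx k) (vtx k) (vtx k) ∸ 1
    below {k} eq = subst (λ v → s k < v ∸ 1) (sym eq)
    last : (∀ k → s k < d (suc m) (vtx k) (vtx k) (vtx k) ∸ 1) → s (fromℕ m) ≡ 0
    last diagonal = n<1⇒n≡0 (subst (λ v → s (fromℕ m) < v ∸ 1) d-diagonal-fromℕ (diagonal (fromℕ m)))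
    bounded : (∀ k → s k < d (suc m) (vtx k) (vtx k) (vtx k) ∸ 1) → ∀ k → s k ≤ 1
    bounded diagonal k with d-diagonal k
    ... | inj₁ refl = subst (_≤ 1) (sym (last diagonal)) z≤n
    ... | inj₂ eq   = s≤s⁻¹ (subst (λ v → s k < v ∸ 1) eq (diagonal k))
    from : (∀ k → s k ≤ 1) × s (fromℕ m) ≡ 0 → ∀ k → s k < d (suc m) (vtx k) (vtx k) (vtx k) ∸ 1
    from (bound , last≡0) k with d-diagonal k
    ... | inj₁ refl = below d-diagonal-fromℕ (subst (_< 1) (sym last≡0) z<s)
    ... | inj₂ eq   = below eq (s≤s (bound k))

corollary3 : (m : ℕ) → (s : Fin (suc m) → ℕ) →
    IsInternalParkingFunction (suc m) s ⇔ (((k : Fin (suc m)) → s k ≤ 1) × s (fromℕ m) ≡ 0)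
corollary3 m s = mk⇔
  (Equivalence.to (diagonal⇔ s) ∘ internal⇒diagonal)
  (λ conditions → diagonal⇒internal (left-endpoint (proj₁ conditions)) (Equivalence.from (diagonal⇔ s) conditions))
  where
  left-endpoint : (∀ k → s k ≤ 1) → ∀ i j → i F.≤ j → s i < d (suc m) (vtx i) (vtx i) (vtx j)
  left-endpoint bound i j _ = ≤-trans (s≤s (bound i)) (d-left-endpoint (suc m) (toℕ i) (vtx j) (toℕ<n i))
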